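{- For every $\Gamma\cup\{\phi\}\subseteq\mathcal{L}_{\Box\Diamond}$: $\Gamma\Vdash^{\mathrm{inm}}\phi$ if and only if $\Gamma\Vdash^{\mathrm{coh}}\phi$.
   Context: $\mathcal{L}_{\Box\Diamond}$: formulas $\phi ::= p_i \mid \bot \mid \phi\wedge\phi \mid \phi\vee\phi \mid \phi\to\phi \mid \Box\phi \mid \Diamond\phi$ over a countable set of proposition letters $p_i$. Intuitionistic neighbourhood models: for a poset $(W,\le)$, an intuitionistic neighbourhood is a partial function $a:W\rightharpoonup\mathcal{P}(W)$ whose domain $\mathrm{dom}(a)$ is an upset. A model is $\mathcal{M}=(W,\le,N,V)$ with $N$ a set of intuitionistic neighbourhoods and $V$ mapping proposition letters to upsets; $N_w=\{a\in N\mid w\in\mathrm{dom}(a)\}$. Truth: $w\Vdash p$ iff $w\in V(p)$; $\bot$ never; $\wedge,\vee$ pointwise; $w\Vdash\phi\to\psi$ iff for all $v\ge w$, $v\Vdash\phi$ implies $v\Vdash\psi$; $w\Vdash\Box\phi$ iff there is $a\in N_w$ such that for all $w'\ge w$ and all $v\in a(w')$, $v\Vdash\phi$; $w\Vdash\Diamond\phi$ iff for all $w'\ge w$ and all $a\in N_{w'}$ there is $v\in a(w')$ with $v\Vdash\phi$. $\Gamma\Vdash^{\mathrm{inm}}\phi$: in every such model, every world satisfying all of $\Gamma$ satisfies $\phi$. An intuitionistic neighbourhood $a$ is coherent if (N1) whenever $w\le w'$ (with $w,w'\in\mathrm{dom}(a)$) and $v\in a(w)$, there is $v'\in a(w')$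 with $v\le v'$; and (N2) whenever $v\in a(w)$ and $v\le v'$, there is $w'\ge w$ with $v'\in a(w')$. A model is coherent if all its neighbourhoods are. $\Gamma\Vdash^{\mathrm{coh}}\phi$: in every coherent model, every world satisfying all of $\Gamma$ satisfies $\phi$. -}

module Defs where

open import Data.Nat using (ℕ)
open import Data.Product using (Σ; ∃; _×_; _,_)
open import Data.Sum using (_⊎_)
open import Data.Empty using (⊥)
open import Level using (Level; 0ℓ) renaming (suc to lsuc)
open import Relation.Binary.PropositionalEquality using (_≡_)
open import Relation.Binary.Structures using (IsPartialOrder)

data Form : Set where
  var  : ℕ → Form
  ⊥'   : Form
  _∧'_ : Form → Form → Form
  _∨'_ : Form → Form → Form
  _⇒'_ : Form → Form → Form
  □_   : Form → Form
  ◇_   : Form → Form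

FormSet : Set₁
FormSet = Form → Set

IsUpset : {W : Set} → (W → W → Set) → (W → Set) → Set
IsUpset {W} _≤_ U = ∀ {w w′} → w ≤ w′ → U w → U w′

-- An intuitionistic neighbourhood on (W, ≤): a partial function
-- a : W ⇀ P(W) with upward-closed domain.  The partial function is
-- represented by its domain 'dom' and a total map 'nb'; the value
-- 'nb w' is only ever consulted for w ∈ dom.
record INbhd {W : Set} (_≤_ : W → W → Set) : Set₁ where
  field
    dom    : W → Set
    dom-up : IsUpset _≤_ dom
    nb     : W → W → Set

record Model : Set₁ where
  field
    W     : Set
    _≤_   : W → W → Set
    isPO  : IsPartialOrder _≡_ _≤_
    Idx   : Set
    N     : Idx → INbhd _≤_
    V     : ℕ → W → Set
    V-up  : ∀ i → IsUpset _≤_ (V i)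

module _ (M : Model) where
  open Model M
  open INbhd

  _∈N_ : Idx → W → Set
  i ∈N w = dom (N i) w

  infix 4 _⊩_
  _⊩_ : W → Form → Set
  w ⊩ var i   = V i w
  w ⊩ ⊥'      = ⊥
  w ⊩ (φ ∧' ψ) = (w ⊩ φ) × (w ⊩ ψ)
  w ⊩ (φ ∨' ψ) = (w ⊩ φ) ⊎ (w ⊩ ψ)
  w ⊩ (φ ⇒' ψ) = ∀ v → w ≤ v → v ⊩ φ → v ⊩ ψ
  w ⊩ (□ φ)   = Σ Idx λ i → i ∈N w ×
                  (∀ w′ → w ≤ w′ → ∀ v → nb (N i) w′ v → v ⊩ φ)
  w ⊩ (◇ φ)   = ∀ w′ → w ≤ w′ → ∀ i → i ∈N w′ →
                  Σ W λ v → nb (N i) w′ v × (v ⊩ φ)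

record Coherent {W : Set} {_≤_ : W → W → Set} (a : INbhd _≤_) : Set where
  open INbhd a
  field
    N1 : ∀ {w w′ v} → dom w → dom w′ → w ≤ w′ → nb w v →
         Σ W λ v′ → nb w′ v′ × (v ≤ v′)
    N2 : ∀ {w v v′} → dom w → nb w v → v ≤ v′ →
         Σ W λ w′ → (w ≤ w′) × dom w′ × nb w′ v′

CoherentModel : Model → Set
CoherentModel M = ∀ i → Coherent (Model.N M i)

_⊩inm_ : FormSet → Form → Set₁
Γ ⊩inm φ = ∀ (M : Model) (w : Model.W M) →
           (∀ ψ → Γ ψ → _⊩_ M w ψ) → _⊩_ M w φ

_⊩coh_ : FormSet → Form → Set₁
Γ ⊩coh φ = ∀ (M : Model) → CoherentModel M → (w : Model.W M) →
           (∀ ψ → Γ ψ → _⊩_ M w ψ) → _⊩_ M w φ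

{-# OPTIONS --safe #-}
-- Every model can be replaced by a coherent one satisfying the same formulas at corresponding
-- worlds; since coherent models are models, the two consequence relations then coincide.
-- The new worlds are pairs (w , n) of an old world and a level n ∈ ℕ, ordered componentwise.
-- Each a ∈ N with a base w₀ ∈ dom a and a base level n₀ gives a neighbourhood with domain
-- ↑(w₀ , n₀) whose value at (w , n) consists of the points over A(w) = ⋃ { a(w″) | w₀ ≤ w″ ≤ w }
-- if n = n₀, and of the points over the upset ↑A(w) if n > n₀. Collecting along [w₀ , w] gives
-- (N1), upward closure one level higher gives (N2), and at its own base such a neighbourhood is
-- a itself, which is what a ◇-formula at (w , n) sees through the base (w , n).
module Submission where

open import Defs
open import Data.Empty using (⊥-elim)
open import Data.Nat using (ℕ; suc) renaming (_≤_ to _≤ℕ_)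
open import Data.Nat.Properties using (≤-refl; ≤-trans; n≤1+n; m≤n⇒m≤1+n; 1+n≰n; ≤-isPartialOrder)
open import Data.Product using (_×_; _,_)
open import Data.Product.Relation.Binary.Pointwise.NonDependent using (Pointwise; ×-isPartialOrder; ≡×≡⇒≡)
open import Data.Sum using (inj₁; inj₂)
open import Relation.Binary.PropositionalEquality using (_≡_; refl; isEquivalence; subst₂)
open import Relation.Binary.Structures using (IsPartialOrder)

module _ (M : Model) where
  open Model M
  open INbhd
  open IsPartialOrder isPO using () renaming (trans to ≤-transᵂ)

  ⊩-mono : ∀ φ {w w′} → w ≤ w′ → _⊩_ M w φ → _⊩_ M w′ φ
  ⊩-mono (var i)  w≤w′ h        = V-up i w≤w′ h
  ⊩-mono ⊥'       w≤w′ ()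
  ⊩-mono (φ ∧' ψ) w≤w′ (hφ , hψ) = ⊩-mono φ w≤w′ hφ , ⊩-mono ψ w≤w′ hψ
  ⊩-mono (φ ∨' ψ) w≤w′ (inj₁ hφ) = inj₁ (⊩-mono φ w≤w′ hφ)
  ⊩-mono (φ ∨' ψ) w≤w′ (inj₂ hψ) = inj₂ (⊩-mono ψ w≤w′ hψ)
  ⊩-mono (φ ⇒' ψ) w≤w′ h        = λ v w′≤v → h v (≤-transᵂ w≤w′ w′≤v)
  ⊩-mono (□ φ)    w≤w′ (i , w∈ , h) =
    i , dom-up (N i) w≤w′ w∈ , λ u w′≤u → h u (≤-transᵂ w≤w′ w′≤u)
  ⊩-mono (◇ φ)    w≤w′ h        = λ u w′≤u → h u (≤-transᵂ w≤w′ w′≤u)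

module Layered (M : Model) where
  open Model M
  open INbhd
  open IsPartialOrder isPO using (antisym) renaming (refl to ≤-reflᵂ; trans to ≤-transᵂ)

  _≤ˡ_ : W × ℕ → W × ℕ → Set
  _≤ˡ_ = Pointwise _≤_ _≤ℕ_

  ≤ˡ-isPartialOrder : IsPartialOrder _≡_ _≤ˡ_
  ≤ˡ-isPartialOrder = record
    { isPreorder = record
      { isEquivalence = isEquivalence
      ; reflexive     = λ { refl → ≤-reflᵂ , ≤-refl }
      ; trans         = IsPartialOrder.trans ×-po
      }
    ; antisym = λ p q → ≡×≡⇒≡ (IsPartialOrder.antisym ×-po p q)
    }
    where ×-po = ×-isPartialOrder isPO ≤-isPartialOrder

  -- (x , m) lies in the value at (w , n) of the neighbourhood built from N i with base (w₀ , n₀).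
  record Lifted (i : Idx) (w₀ : W) (n₀ : ℕ) (w : W) (n : ℕ) (x : W) : Set where
    field
      origin      : W
      source      : W
      base≤origin : w₀ ≤ origin
      origin≤w    : origin ≤ w
      source∈     : nb (N i) origin source
      exact       : n ≤ℕ n₀ → source ≡ x
      source≤x    : source ≤ x

  lifted-own : ∀ {i w₀ n₀ w n v} → w₀ ≤ w → nb (N i) w v → Lifted i w₀ n₀ w n v
  lifted-own {w = w} {v = v} w₀≤w v∈ = record
    { origin = w ; source = v ; base≤origin = w₀≤w ; origin≤w = ≤-reflᵂ
    ; source∈ = v∈ ; exact = λ _ → refl ; source≤x = ≤-reflᵂ }

  lifted-at-base : ∀ {i w₀ n₀ x} → Lifted i w₀ n₀ w₀ n₀ x → nb (N i) w₀ x
  lifted-at-base {i} r = subst₂ (nb (N i)) (antisym origin≤w base≤origin) (exact ≤-refl) source∈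
    where open Lifted r

  lifted-mono : ∀ {i w₀ n₀ w w′ n n′ x} → w ≤ w′ → n ≤ℕ n′ →
                Lifted i w₀ n₀ w n x → Lifted i w₀ n₀ w′ n′ x
  lifted-mono w≤w′ n≤n′ r = record
    { origin = origin ; source = source ; base≤origin = base≤origin
    ; origin≤w = ≤-transᵂ origin≤w w≤w′ ; source∈ = source∈
    ; exact = λ n′≤n₀ → exact (≤-trans n≤n′ n′≤n₀) ; source≤x = source≤x }
    where open Lifted r

  lifted-step : ∀ {i w₀ n₀ w n x x′} → n₀ ≤ℕ n → x ≤ x′ →
                Lifted i w₀ n₀ w n x → Lifted i w₀ n₀ w (suc n) x′
  lifted-step n₀≤n x≤x′ r = record
    { origin = origin ; source = source ; base≤origin = base≤origin
    ; origin≤w = origin≤w ; source∈ = source∈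
    ; exact = λ 1+n≤n₀ → ⊥-elim (1+n≰n (≤-trans 1+n≤n₀ n₀≤n))
    ; source≤x = ≤-transᵂ source≤x x≤x′ }
    where open Lifted r

  lift : Idx × W × ℕ → INbhd _≤ˡ_
  lift (i , w₀ , n₀) = record
    { dom    = λ { (w , n) → dom (N i) w₀ × w₀ ≤ w × n₀ ≤ℕ n }
    ; dom-up = λ { (w≤w′ , n≤n′) (w₀∈ , w₀≤w , n₀≤n) →
                   w₀∈ , ≤-transᵂ w₀≤w w≤w′ , ≤-trans n₀≤n n≤n′ }
    ; nb     = λ { (w , n) (x , _) → Lifted i w₀ n₀ w n x }
    }

  layered : Model
  layered = record
    { W = W × ℕ ; _≤_ = _≤ˡ_ ; isPO = ≤ˡ-isPartialOrder
    ; Idx = Idx × W × ℕ ; N = lift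
    ; V = λ i (w , _) → V i w ; V-up = λ i (w≤w′ , _) → V-up i w≤w′
    }

  layered-coherent : CoherentModel layered
  layered-coherent (i , w₀ , n₀) = record
    { N1 = λ { {v = x , m} _ _ (w≤w′ , n≤n′) r →
               (x , m) , lifted-mono w≤w′ n≤n′ r , ≤-reflᵂ , ≤-refl }
    ; N2 = λ { {w = w , n} (w₀∈ , w₀≤w , n₀≤n) r (x≤x′ , _) →
               (w , suc n) , (≤-reflᵂ , n≤1+n n) , (w₀∈ , w₀≤w , m≤n⇒m≤1+n n₀≤n)
               , lifted-step n₀≤n x≤x′ r }
    }

  _⊩ᴹ_ : W → Form → Set
  _⊩ᴹ_ = _⊩_ M

  _⊩ˡ_ : W × ℕ → Form → Set
  _⊩ˡ_ = _⊩_ layered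

  lower : ∀ φ {w n} → (w , n) ⊩ˡ φ → w ⊩ᴹ φ
  raise : ∀ φ {w} n → w ⊩ᴹ φ → (w , n) ⊩ˡ φ

  lower (var i)  h         = h
  lower ⊥'       ()
  lower (φ ∧' ψ) (hφ , hψ) = lower φ hφ , lower ψ hψ
  lower (φ ∨' ψ) (inj₁ hφ) = inj₁ (lower φ hφ)
  lower (φ ∨' ψ) (inj₂ hψ) = inj₂ (lower ψ hψ)
  lower (φ ⇒' ψ) {n = n} h v w≤v hφ = lower ψ (h (v , n) (w≤v , ≤-refl) (raise φ n hφ))
  lower (□ φ) {n = n} ((i , w₀ , _) , (w₀∈ , w₀≤w , _) , h) =
    i , dom-up (N i) w₀≤w w₀∈ ,
    λ w′ w≤w′ v v∈ → lower φ (h (w′ , n) (w≤w′ , ≤-refl) (v , 0)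
                                 (lifted-own (≤-transᵂ w₀≤w w≤w′) v∈))
  lower (◇ φ) {n = n} h w′ w≤w′ i w′∈
    with h (w′ , n) (w≤w′ , ≤-refl) (i , w′ , n) (w′∈ , ≤-reflᵂ , ≤-refl)
  ... | (x , _) , r , hx = x , lifted-at-base r , lower φ hx

  raise (var i)  n h         = h
  raise ⊥'       n ()
  raise (φ ∧' ψ) n (hφ , hψ) = raise φ n hφ , raise ψ n hψ
  raise (φ ∨' ψ) n (inj₁ hφ) = inj₁ (raise φ n hφ)
  raise (φ ∨' ψ) n (inj₂ hψ) = inj₂ (raise ψ n hψ)
  raise (φ ⇒' ψ) n h (v , m) (w≤v , _) hφ = raise ψ m (h v w≤v (lower φ hφ))
  raise (□ φ) {w} n (i , w∈ , h) =
    (i , w , n) , (w∈ , ≤-reflᵂ , ≤-refl) ,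
    λ { _ _ (x , m) r → let open Lifted r in
          raise φ m (⊩-mono M φ source≤x (h origin base≤origin source source∈)) }
  raise (◇ φ) n h (w′ , _) (w≤w′ , _) (i , w₀ , _) (w₀∈ , w₀≤w′ , _)
    with h w′ w≤w′ i (dom-up (N i) w₀≤w′ w₀∈)
  ... | v , v∈ , hv = (v , 0) , lifted-own w₀≤w′ v∈ , raise φ 0 hv

theorem3p14 : (Γ : FormSet) (φ : Form) → (Γ ⊩inm φ → Γ ⊩coh φ) × (Γ ⊩coh φ → Γ ⊩inm φ)
theorem3p14 Γ φ = (λ inm M _ → inm M) , coh⇒inm
  where
  coh⇒inm : Γ ⊩coh φ → Γ ⊩inm φ
  coh⇒inm coh M w Γ-at-w =
    lower φ (coh layered layered-coherent (w , 0) λ ψ ψ∈Γ → raise ψ 0 (Γ-at-w ψ ψ∈Γ))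
    where open Layered M
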